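{- Let $m$ be a stack $\mathbb{T}$-automaton over a finite stack alphabet $\Gamma$. Then for any state $x_0\in X$ and any $\gamma_0\in\Gamma$, the language $\{w\in A^*\mid [\![x_0]\!]_m(w)(\gamma_0)=1\}$ is a real-time deterministic context-free language. Conversely, for any real-time deterministic context-free language $\mathcal{L}\subseteq A^*$ there exists a stack $\mathbb{T}$-automaton $m$, a state $x_0$ and $\gamma_0\in\Gamma$ such that $\mathcal{L}=\{w\in A^*\mid [\![x_0]\!]_m(w)(\gamma_0)=1\}$.
   Context: $A$ is a finite input alphabet, $L=B\times(-)^A$, and $B^{A^*}$ is the final $L$-coalgebra ($o(\sigma)=\sigma(\varepsilon)$, $\partial_a\sigma=\lambda w.\sigma(aw)$). The stack monad over $\Gamma$ is the submonad $\mathbb{T}$ of the store monad $X\mapsto(X\times\Gamma^*)^{\Gamma^*}$ whose elements $\langle r,t\rangle\in TX$ satisfy: there is $k$ such that $r(wu)=r(w)$ and $t(wu)=t(w)u$ for all $w\in\Gamma^k$, $u\in\Gamma^*$. A stack $\mathbb{T}$-automaton $m$ is given by a finite set $X$, maps $o^m:X\to B$, $t^m:A\times X\to TX$, and $a^m:TB\to B$, where $B$ is the set of predicates $p\in 2^{\Gamma^*}$ for which there is $k$ with $p(wu)=p(w)$ whenever $|w|\ge k$, and $a^m$ is evaluation: $a^m(\langle r,t\rangle)(s)=r(s)(t(s))$. Its trace semantics $[\![x]\!]_m:A^*\to B$ is defined by the generalized powerset construction: the unique $\mathbb{T}$-algebra morphism $m^\sharp:TX\to B\times(TX)^A$ extending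 $\langle o^m,t^m\rangle$ along $\eta$ (with pointwise algebra structure on $B\times(TX)^A$) makes $TX$ an $L$-coalgebra, and $[\![x]\!]_m$ is the image of $\eta(x)$ under the unique $L$-coalgebra morphism $TX\to B^{A^*}$. -}

module Defs where

open import Data.Nat using (ℕ; _≤_)
open import Data.Fin using (Fin)
open import Data.List using (List; []; _∷_; _++_; length)
open import Data.Bool using (Bool; true; false)
open import Data.Product using (Σ; _×_; _,_; proj₁; proj₂)
open import Data.Maybe using (Maybe; just; nothing)
open import Relation.Binary.PropositionalEquality using (_≡_)
open import Function.Bundles using (_⇔_)

-- Underlying store-monad elements ⟨r , t⟩ ∈ (X × Γ*)^(Γ*), split in components.
RawT : Set → Set → Set
RawT Γ X = (List Γ → X) × (List Γ → List Γ)

IsStackElem : {Γ X : Set} → RawT Γ X → Set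
IsStackElem {Γ} (r , t) =
  Σ ℕ λ k → (w u : List Γ) → length w ≡ k →
    (r (w ++ u) ≡ r w) × (t (w ++ u) ≡ t w ++ u)

record T (Γ X : Set) : Set where
  field
    elem    : RawT Γ X
    isStack : IsStackElem elem

IsStackPred : {Γ : Set} → (List Γ → Bool) → Set
IsStackPred {Γ} p =
  Σ ℕ λ k → (w u : List Γ) → k ≤ length w → p (w ++ u) ≡ p w

record B (Γ : Set) : Set where
  field
    pred    : List Γ → Bool
    isStack : IsStackPred pred

-- The algebra a^m : TB → B is fixed to be
-- evaluation a^m ⟨r,t⟩ (s) = r(s)(t(s)), so it is not a field.

record StackAut (nA nΓ nX : ℕ) : Set where
  field
    out   : Fin nX → B (Fin nΓ)
    trans : Fin nA × Fin nX → T (Fin nΓ) (Fin nX)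

module Semantics {nA nΓ nX : ℕ} (m : StackAut nA nΓ nX) where
  open StackAut m
  Γ = Fin nΓ
  X = Fin nX
  A = Fin nA

  η : X → RawT Γ X
  η x = (λ _ → x) , (λ s → s)

  -- output component of m♯ : a^m ∘ T o^m
  out♯ : RawT Γ X → List Γ → Bool
  out♯ (r , t) s = B.pred (out (r s)) (t s)

  -- transition component of m♯ : μ ∘ T (t^m(a,-))
  δ♯ : A → RawT Γ X → RawT Γ X
  δ♯ a (r , t) =
    (λ s → proj₁ (T.elem (trans (a , r s))) (t s)) ,
    (λ s → proj₂ (T.elem (trans (a , r s))) (t s))

  -- unique L-coalgebra morphism into the final coalgebra B^(A*)
  beh : RawT Γ X → List A → List Γ → Bool
  beh τ []      = out♯ τ
  beh τ (a ∷ w) = beh (δ♯ a τ) w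

  ⟦_⟧ : X → List A → List Γ → Bool
  ⟦ x ⟧ = beh (η x)

trace : {nA nΓ nX : ℕ} → StackAut nA nΓ nX → Fin nX → List (Fin nA) → List (Fin nΓ) → Bool
trace m = Semantics.⟦_⟧ m

-- Real-time deterministic pushdown automata (no ε-moves), acceptance by
-- final state; δ is partial (nothing = block/reject).

record RTDPDA (nA nQ nΣ : ℕ) : Set where
  field
    q₀    : Fin nQ
    Z₀    : Fin nΣ
    δ     : Fin nQ → Fin nA → Fin nΣ → Maybe (Fin nQ × List (Fin nΣ))
    final : Fin nQ → Bool

module DPDARun {nA nQ nΣ : ℕ} (P : RTDPDA nA nQ nΣ) where
  open RTDPDA P
  Config = Fin nQ × List (Fin nΣ)

  step : Fin nA → Config → Maybe Config
  step a (q , [])    = nothing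
  step a (q , Z ∷ γ) with δ q a Z
  ... | nothing        = nothing
  ... | just (q' , α)  = just (q' , α ++ γ)

  runFrom : Config → List (Fin nA) → Maybe Config
  runFrom c []      = just c
  runFrom c (a ∷ w) with step a c
  ... | nothing = nothing
  ... | just c' = runFrom c' w

  accepts : List (Fin nA) → Bool
  accepts w with runFrom (q₀ , Z₀ ∷ []) w
  ... | nothing      = false
  ... | just (q , _) = final q

Accepts : {nA nQ nΣ : ℕ} → RTDPDA nA nQ nΣ → List (Fin nA) → Bool
Accepts P = DPDARun.accepts P

Language : ℕ → Set₁
Language nA = List (Fin nA) → Set

IsRTDCFL : {nA : ℕ} → Language nA → Set
IsRTDCFL {nA} L =
  Σ ℕ λ nQ → Σ ℕ λ nΣ → Σ (RTDPDA nA nQ nΣ) λ P →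
    (w : List (Fin nA)) → L w ⇔ (Accepts P w ≡ true)

traceLang : {nA nΓ nX : ℕ} → StackAut nA nΓ nX → Fin nX → Fin nΓ → Language nA
traceLang m x₀ γ₀ w = trace m x₀ w (γ₀ ∷ []) ≡ true

module Submission where

-- A stack T-automaton only ever touches a bounded top segment of its stack: by finiteness there is
-- one K > 0 such that every transition rewrites only the top K symbols and every output predicate
-- reads only the top K symbols.  The trace semantics is the output of an ordinary run on
-- configurations (state, stack).  A real-time DPDA simulates this run by keeping a buffer of at most
-- 3K top symbols in its finite control and the rest of the stack as pushdown symbols, each a chunk of
-- K to 2K symbols, above a bottom marker.  Whenever chunks lie below it the buffer holds at least K
-- symbols, so a transition of the automaton only touches the buffer.  In each step the DPDA pops one
-- symbol, applies the transition to the buffer, and then either merges a short result (fewer than K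
-- symbols) with the popped chunk, or splits a long result into a new buffer and fresh chunks, which it
-- pushes together with the popped symbol.
-- Conversely, a real-time DPDA is a stack automaton whose transitions read only the top symbol, with
-- an extra rejecting sink state for blocked runs.

open import Defs
open import Data.Nat using (ℕ; zero; suc; _+_; _*_; _⊔_; _≤_; _<_; s≤s; z<s; _≤?_; _<?_)
open import Data.Nat.Properties
  using (≤-reflexive; ≤-trans; ≤-<-trans; <⇒≤; ≮⇒≥; ≰⇒>; m≤m+n; m≤n+m; m≤m⊔n; m≤n⊔m;
         m≤n⇒m≤1+n; m≤n⇒m⊓n≡m; +-mono-≤; +-monoˡ-≤; +-monoʳ-<; m<m+n; m+n≤o⇒m≤o∸n; m≤n+o⇒m∸n≤o)
open import Data.Fin using (Fin; zero; suc; combine; remQuot)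
open import Data.Fin.Properties using (remQuot-combine)
open import Data.List using (List; []; _∷_; _++_; length; map; concat; take; drop)
open import Data.List.Properties
  using (++-assoc; ++-identityʳ; length-++; length-++-≤ʳ; length-take; length-drop; take++drop≡id;
         map-++; concat-++)
open import Data.List.Relation.Unary.All using (All; []; _∷_)
open import Data.List.Relation.Unary.All.Properties using (++⁺)
open import Data.Bool using (Bool; false)
open import Data.Maybe using (Maybe; just; nothing)
open import Data.Product using (Σ; _×_; _,_; proj₁; proj₂; map₂; uncurry; uncurry′)
open import Data.Sum using (_⊎_; inj₁; inj₂)
open import Function.Bundles using (_⇔_; mk⇔)
open import Function.Properties.Equivalence using () renaming (trans to ⇔-trans)
open import Relation.Binary.PropositionalEquality
  using (_≡_; refl; sym; trans; cong; cong₂; subst; module ≡-Reasoning)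
open import Relation.Nullary using (yes; no)

open ≡-Reasoning

bounded : ∀ {n} (f : Fin n → ℕ) → Σ ℕ λ M → ∀ i → f i ≤ M
bounded {zero}  f = 0 , λ ()
bounded {suc n} f with bounded (λ i → f (suc i))
... | M , f≤M = f zero ⊔ M , λ { zero → m≤m⊔n _ _ ; (suc i) → ≤-trans (f≤M i) (m≤n⊔m _ _) }

bounded₂ : ∀ {m n} (f : Fin m → Fin n → ℕ) → Σ ℕ λ M → ∀ i j → f i j ≤ M
bounded₂ f with bounded (λ i → proj₁ (bounded (f i)))
... | M , h = M , λ i j → ≤-trans (proj₂ (bounded (f i)) j) (h i)

length-take-≤ : ∀ {A : Set} k (v : List A) → k ≤ length v → length (take k v) ≡ k
length-take-≤ k v k≤v = trans (length-take k v) (m≤n⇒m⊓n≡m k≤v)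

split-prefix : ∀ {A : Set} k (v : List A) → k ≤ length v →
  Σ (List A) λ w → Σ (List A) λ d → length w ≡ k × w ++ d ≡ v
split-prefix k v k≤v = take k v , drop k v , length-take-≤ k v k≤v , take++drop≡id k v

stack-elem-local : {Γ X : Set} {r : List Γ → X} {t : List Γ → List Γ} (p : IsStackElem (r , t)) →
  ∀ v u → proj₁ p ≤ length v → r (v ++ u) ≡ r v × t (v ++ u) ≡ t v ++ u
stack-elem-local {r = r} {t} (k , local) v u k≤v with split-prefix k v k≤v
... | w , d , refl , refl = r-local , t-local
  where
  r-local : r ((w ++ d) ++ u) ≡ r (w ++ d)
  r-local = begin
    r ((w ++ d) ++ u)  ≡⟨ cong r (++-assoc w d u) ⟩
    r (w ++ (d ++ u))  ≡⟨ proj₁ (local w (d ++ u) refl) ⟩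
    r w                ≡⟨ proj₁ (local w d refl) ⟨
    r (w ++ d)         ∎
  t-local : t ((w ++ d) ++ u) ≡ t (w ++ d) ++ u
  t-local = begin
    t ((w ++ d) ++ u)    ≡⟨ cong t (++-assoc w d u) ⟩
    t (w ++ (d ++ u))    ≡⟨ proj₂ (local w (d ++ u) refl) ⟩
    t w ++ (d ++ u)      ≡⟨ ++-assoc (t w) d u ⟨
    (t w ++ d) ++ u      ≡⟨ cong (_++ u) (proj₂ (local w d refl)) ⟨
    t (w ++ d) ++ u      ∎

pureT : {Γ X : Set} → X → T Γ X
pureT x = record
  { elem    = (λ _ → x) , (λ s → s)
  ; isStack = 0 , λ { [] _ refl → refl , refl ; (_ ∷ _) _ () } }

readTop : {Γ X : Set} → X → (Γ → X × List Γ) → T Γ X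
readTop {Γ} {X} onEmpty f = record { elem = r , t ; isStack = 1 , local }
  where
  r : List Γ → X
  r []      = onEmpty
  r (g ∷ _) = proj₁ (f g)
  t : List Γ → List Γ
  t []      = []
  t (g ∷ s) = proj₂ (f g) ++ s
  local : (w u : List Γ) → length w ≡ 1 → r (w ++ u) ≡ r w × t (w ++ u) ≡ t w ++ u
  local (g ∷ []) u refl = refl , cong (_++ u) (sym (++-identityʳ (proj₂ (f g))))
  local []           _ ()
  local (_ ∷ _ ∷ _)  _ ()

constB : {Γ : Set} → Bool → B Γ
constB b = record { pred = λ _ → b ; isStack = 0 , λ _ _ _ → refl }

module Configurations {nA nΓ nX : ℕ} (m : StackAut nA nΓ nX) where
  open StackAut m renaming (trans to transition)

  Config : Set
  Config = Fin nX × List (Fin nΓ)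

  step : Fin nA → Config → Config
  step a (x , s) = proj₁ τ s , proj₂ τ s
    where τ = T.elem (transition (a , x))

  run : Config → List (Fin nA) → Config
  run c []      = c
  run c (a ∷ w) = run (step a c) w

  output : Config → Bool
  output (x , s) = B.pred (out x) s

  beh≡run : ∀ w τ s → Semantics.beh m τ w s ≡ output (run (proj₁ τ s , proj₂ τ s) w)
  beh≡run []      τ s = refl
  beh≡run (a ∷ w) τ s = beh≡run w (Semantics.δ♯ m a τ) s

  trace≡run : ∀ x w s → trace m x w s ≡ output (run (x , s) w)
  trace≡run x w = beh≡run w (Semantics.η m x)

  record LocalAt (K : ℕ) : Set where
    field
      step-local   : ∀ a x v u → K ≤ length v → step a (x , v ++ u) ≡ map₂ (_++ u) (step a (x , v))
      output-local : ∀ x v u → K ≤ length v → output (x , v ++ u) ≡ output (x , v)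

  transition-depth : Fin nA → Fin nX → ℕ
  transition-depth a x = proj₁ (T.isStack (transition (a , x)))

  output-depth : Fin nX → ℕ
  output-depth x = proj₁ (B.isStack (out x))

  localAt : ∀ K → (∀ a x → transition-depth a x ≤ K) → (∀ x → output-depth x ≤ K) → LocalAt K
  localAt K t≤K o≤K = record
    { step-local   = λ a x v u K≤v → uncurry (cong₂ _,_)
        (stack-elem-local (T.isStack (transition (a , x))) v u (≤-trans (t≤K a x) K≤v))
    ; output-local = λ x v u K≤v → proj₂ (B.isStack (out x)) v u (≤-trans (o≤K x) K≤v) }

  bounded-locality : Σ ℕ λ K → 0 < K × LocalAt K
  bounded-locality with bounded₂ transition-depth | bounded output-depth
  ... | Mt , t≤Mt | Mo , o≤Mo = suc (Mt ⊔ Mo) , z<s , localAt _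
    (λ a x → m≤n⇒m≤1+n (≤-trans (t≤Mt a x) (m≤m⊔n Mt Mo)))
    (λ x → m≤n⇒m≤1+n (≤-trans (o≤Mo x) (m≤n⊔m Mt Mo)))

module Acceptance {nA nQ nΣ : ℕ} (P : RTDPDA nA nQ nΣ) where
  open RTDPDA P
  open DPDARun P

  accepting : Maybe Config → Bool
  accepting nothing        = false
  accepting (just (q , _)) = final q

  accepts≡accepting : ∀ w → Accepts P w ≡ accepting (runFrom (q₀ , Z₀ ∷ []) w)
  accepts≡accepting w with runFrom (q₀ , Z₀ ∷ []) w
  ... | nothing = refl
  ... | just _  = refl

  runFrom-step : ∀ {a c c'} w → step a c ≡ just c' → runFrom c (a ∷ w) ≡ runFrom c' w
  runFrom-step w eq rewrite eq = refl

module FromRTDPDA {nA nQ nΣ : ℕ} (P : RTDPDA nA nQ nΣ) where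
  open RTDPDA P
  open DPDARun P using (runFrom)
  open Acceptance P

  resume : Maybe (Fin nQ × List (Fin nΣ)) → Fin (suc nQ) × List (Fin nΣ)
  resume nothing         = zero , []
  resume (just (q , α)) = suc q , α

  automaton : StackAut nA nΣ (suc nQ)
  automaton = record
    { out   = λ { zero → constB false ; (suc q) → constB (final q) }
    ; trans = λ { (a , zero) → pureT zero ; (a , suc q) → readTop zero (λ Z → resume (δ q a Z)) } }

  open Configurations automaton

  sink-rejects : ∀ w s → output (run (zero , s) w) ≡ false
  sink-rejects []      s = refl
  sink-rejects (a ∷ w) s = sink-rejects w s

  run≡runFrom : ∀ w q γ → output (run (suc q , γ) w) ≡ accepting (runFrom (q , γ) w)
  run≡runFrom []      q γ       = refl
  run≡runFrom (a ∷ w) q []      = sink-rejects w []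
  run≡runFrom (a ∷ w) q (Z ∷ γ) with δ q a Z
  ... | nothing        = sink-rejects w γ
  ... | just (q' , α) = run≡runFrom w q' (α ++ γ)

  trace-automaton : ∀ w → trace automaton (suc q₀) w (Z₀ ∷ []) ≡ Accepts P w
  trace-automaton w = begin
    trace automaton (suc q₀) w (Z₀ ∷ [])        ≡⟨ trace≡run (suc q₀) w (Z₀ ∷ []) ⟩
    output (run (suc q₀ , Z₀ ∷ []) w)          ≡⟨ run≡runFrom w q₀ (Z₀ ∷ []) ⟩
    accepting (runFrom (q₀ , Z₀ ∷ []) w)       ≡⟨ accepts≡accepting w ⟨
    Accepts P w                                ∎

module BoundedListCode (n : ℕ) where
  size : ℕ → ℕ
  size zero    = 1
  size (suc L) = suc (n * size L)

  encode : ∀ L → List (Fin n) → Fin (size L)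
  encode zero    _       = zero
  encode (suc L) []      = zero
  encode (suc L) (g ∷ l) = suc (combine g (encode L l))

  decode : ∀ L → Fin (size L) → List (Fin n)
  decode zero    _       = []
  decode (suc L) zero    = []
  decode (suc L) (suc i) = uncurry′ (λ g j → g ∷ decode L j) (remQuot (size L) i)

  decode-encode : ∀ L l → length l ≤ L → decode L (encode L l) ≡ l
  decode-encode zero    []      _         = refl
  decode-encode (suc L) []      _         = refl
  decode-encode (suc L) (g ∷ l) (s≤s l≤L) = begin
    uncurry′ (λ g j → g ∷ decode L j) (remQuot (size L) (combine g (encode L l)))
      ≡⟨ cong (uncurry′ (λ g j → g ∷ decode L j)) (remQuot-combine g (encode L l)) ⟩
    g ∷ decode L (encode L l)
      ≡⟨ cong (g ∷_) (decode-encode L l l≤L) ⟩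
    g ∷ l ∎

module Chunking {Γ : Set} (K : ℕ) (0<K : 0 < K) where
  Chunk : List Γ → Set
  Chunk c = K ≤ length c × length c < K + K

  record Chunked (v : List Γ) : Set where
    field
      head       : List Γ
      chunks     : List (List Γ)
      head-chunk : Chunk head
      all-chunks : All Chunk chunks
      reassemble : head ++ concat chunks ≡ v

  private
    single : ∀ v → K ≤ length v → length v < K + K → Chunked v
    single v K≤v v<2K = record
      { head = v ; chunks = [] ; head-chunk = K≤v , v<2K ; all-chunks = []
      ; reassemble = ++-identityʳ v }

    -- n is fuel: at most n chunks are split off, enough as long as length v ≤ K + n
    chunk-within : ∀ n v → K ≤ length v → length v ≤ K + n → Chunked v
    chunk-within zero    v K≤v v≤K = single v K≤v (≤-<-trans v≤K (+-monoʳ-< K 0<K))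
    chunk-within (suc n) v K≤v v≤K+n with K + K ≤? length v
    ... | no  v≱2K = single v K≤v (≰⇒> v≱2K)
    ... | yes 2K≤v = record
      { head       = take K v
      ; chunks     = Chunked.head rest ∷ Chunked.chunks rest
      ; head-chunk = ≤-reflexive (sym |take|) , subst (_< K + K) (sym |take|) (m<m+n K 0<K)
      ; all-chunks = Chunked.head-chunk rest ∷ Chunked.all-chunks rest
      ; reassemble = trans (cong (take K v ++_) (Chunked.reassemble rest)) (take++drop≡id K v) }
      where
      |take| : length (take K v) ≡ K
      |take| = length-take-≤ K v (≤-trans (m≤m+n K K) 2K≤v)
      K≤drop : K ≤ length (drop K v)
      K≤drop = subst (K ≤_) (sym (length-drop K v)) (m+n≤o⇒m≤o∸n K 2K≤v)
      drop≤ : length (drop K v) ≤ K + n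
      drop≤ = subst (_≤ K + n) (sym (length-drop K v))
                (≤-trans (m≤n+o⇒m∸n≤o (length v) K v≤K+n) (+-monoˡ-≤ n 0<K))
      rest = chunk-within n (drop K v) K≤drop drop≤

  chunk : ∀ v → K ≤ length v → Chunked v
  chunk v K≤v = chunk-within (length v) v K≤v (m≤n+m (length v) K)

module ToRTDPDA {nA nΓ nX : ℕ} (m : StackAut nA nΓ nX) (K : ℕ) (0<K : 0 < K)
                (local : Configurations.LocalAt m K) where
  open Configurations m
  open LocalAt local
  open Chunking {Fin nΓ} K 0<K
  open BoundedListCode nΓ

  Γ* : Set
  Γ* = List (Fin nΓ)

  -- nothing is the bottom marker, just c a chunk c; stack cs holds the chunks cs, topmost first
  Symbol : Set
  Symbol = Maybe Γ*

  top : List Γ* → Symbol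
  top []      = nothing
  top (c ∷ _) = just c

  stack below : List Γ* → List Symbol
  stack cs = top cs ∷ below cs
  below []       = []
  below (_ ∷ cs) = stack cs

  stack-++ : ∀ bs cs → stack (bs ++ cs) ≡ map just bs ++ stack cs
  stack-++ []       cs = refl
  stack-++ (b ∷ bs) cs = cong (just b ∷_) (stack-++ bs cs)

  push : Γ* → Symbol → Γ* × List Symbol
  push v z with length v <? K
  push v nothing  | yes _ = v , nothing ∷ []
  push v (just c) | yes _ = v ++ c , []
  push v z        | no v≮K = Chunked.head vc , map just (Chunked.chunks vc) ++ z ∷ []
    where vc = chunk v (≮⇒≥ v≮K)

  bufferBound chunkBound : ℕ
  bufferBound = K + (K + K)
  chunkBound  = K + K

  Deep : Γ* → Γ* → Set
  Deep b s = s ≡ [] ⊎ K ≤ length b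

  record WellFormed (b : Γ*) (cs : List Γ*) : Set where
    field
      all-chunks  : All Chunk cs
      buffer-fits : length b ≤ bufferBound
      deep        : Deep b (concat cs)
  open WellFormed

  push-correct : ∀ v cs → All Chunk cs →
    Σ (List Γ*) λ cs' → WellFormed (proj₁ (push v (top cs))) cs'
      × proj₂ (push v (top cs)) ++ below cs ≡ stack cs'
      × v ++ concat cs ≡ proj₁ (push v (top cs)) ++ concat cs'
  push-correct v cs cs-ok with length v <? K
  push-correct v []       [] | yes v<K =
    [] , record { all-chunks = [] ; buffer-fits = ≤-trans (<⇒≤ v<K) (m≤m+n K _) ; deep = inj₁ refl } ,
    refl , refl
  push-correct v (c ∷ cs) (c-ok ∷ cs-ok) | yes v<K =
    cs , record { all-chunks = cs-ok ; buffer-fits = fits ; deep = inj₂ K≤v++c } ,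
    refl , sym (++-assoc v c (concat cs))
    where
    fits : length (v ++ c) ≤ bufferBound
    fits = ≤-trans (≤-reflexive (length-++ v)) (+-mono-≤ (<⇒≤ v<K) (<⇒≤ (proj₂ c-ok)))
    K≤v++c : K ≤ length (v ++ c)
    K≤v++c = ≤-trans (proj₁ c-ok) (length-++-≤ʳ c {v})
  push-correct v cs cs-ok | no v≮K =
    bs ++ cs ,
    record { all-chunks = ++⁺ (Chunked.all-chunks vc) cs-ok ; buffer-fits = fits ; deep = inj₂ (proj₁ h-ok) } ,
    stack-eq , concat-eq
    where
    vc = chunk v (≮⇒≥ v≮K)
    h = Chunked.head vc
    bs = Chunked.chunks vc
    h-ok = Chunked.head-chunk vc
    fits : length h ≤ bufferBound
    fits = ≤-trans (<⇒≤ (proj₂ h-ok)) (m≤n+m (K + K) K)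
    stack-eq : (map just bs ++ top cs ∷ []) ++ below cs ≡ stack (bs ++ cs)
    stack-eq = trans (++-assoc (map just bs) _ _) (sym (stack-++ bs cs))
    concat-eq : v ++ concat cs ≡ h ++ concat (bs ++ cs)
    concat-eq = begin
      v ++ concat cs                 ≡⟨ cong (_++ concat cs) (Chunked.reassemble vc) ⟨
      (h ++ concat bs) ++ concat cs  ≡⟨ ++-assoc h (concat bs) (concat cs) ⟩
      h ++ (concat bs ++ concat cs)  ≡⟨ cong (h ++_) (concat-++ bs cs) ⟩
      h ++ concat (bs ++ cs)         ∎

  step-deep : ∀ a x {b s} → Deep b s → step a (x , b ++ s) ≡ map₂ (_++ s) (step a (x , b))
  step-deep a x {b} (inj₁ refl) =
    trans (cong (λ s → step a (x , s)) (++-identityʳ b)) (cong (_ ,_) (sym (++-identityʳ _)))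
  step-deep a x {b} {s} (inj₂ K≤b) = step-local a x b s K≤b

  output-deep : ∀ x {b s} → Deep b s → output (x , b ++ s) ≡ output (x , b)
  output-deep x {b} (inj₁ refl) = cong (λ s → output (x , s)) (++-identityʳ b)
  output-deep x {b} {s} (inj₂ K≤b) = output-local x b s K≤b

  nQ nS : ℕ
  nQ = nX * size bufferBound
  nS = suc (size chunkBound)

  encodeState : Config → Fin nQ
  encodeState (x , b) = combine x (encode bufferBound b)

  decodeState : Fin nQ → Config
  decodeState q = map₂ (decode bufferBound) (remQuot (size bufferBound) q)

  decode-encodeState : ∀ x b → length b ≤ bufferBound → decodeState (encodeState (x , b)) ≡ (x , b)
  decode-encodeState x b fits = trans (cong (map₂ (decode bufferBound)) (remQuot-combine x _))
                                      (cong (x ,_) (decode-encode bufferBound b fits))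

  encodeSymbol : Symbol → Fin nS
  encodeSymbol nothing  = zero
  encodeSymbol (just c) = suc (encode chunkBound c)

  decodeSymbol : Fin nS → Symbol
  decodeSymbol zero    = nothing
  decodeSymbol (suc i) = just (decode chunkBound i)

  decode-encodeTop : ∀ cs → All Chunk cs → decodeSymbol (encodeSymbol (top cs)) ≡ top cs
  decode-encodeTop []      _          = refl
  decode-encodeTop (c ∷ _) (c-ok ∷ _) = cong just (decode-encode chunkBound c (<⇒≤ (proj₂ c-ok)))

  move : Fin nA → Config → Symbol → Config × List Symbol
  move a c z = (proj₁ c' , proj₁ pushed) , proj₂ pushed
    where
    c' = step a c
    pushed = push (proj₂ c') z

  encodeConfig : Config → List Symbol → Fin nQ × List (Fin nS)
  encodeConfig c zs = encodeState c , map encodeSymbol zs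

  dpda : Fin nX → Fin nΓ → RTDPDA nA nQ nS
  dpda x₀ γ₀ = record
    { q₀    = encodeState (x₀ , γ₀ ∷ [])
    ; Z₀    = encodeSymbol nothing
    ; δ     = λ q a Z → just (uncurry′ encodeConfig (move a (decodeState q) (decodeSymbol Z)))
    ; final = λ q → output (decodeState q) }

  module _ (x₀ : Fin nX) (γ₀ : Fin nΓ) where
    open DPDARun (dpda x₀ γ₀) using () renaming (step to dpda-step; runFrom to dpda-run)
    open Acceptance (dpda x₀ γ₀)

    dpda-step-encoded : ∀ a c z γ → decodeState (encodeState c) ≡ c → decodeSymbol (encodeSymbol z) ≡ z →
      dpda-step a (encodeState c , encodeSymbol z ∷ γ)
        ≡ just (encodeState (proj₁ (move a c z)) , map encodeSymbol (proj₂ (move a c z)) ++ γ)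
    dpda-step-encoded a c z γ = cong₂ λ c z →
      just (encodeState (proj₁ (move a c z)) , map encodeSymbol (proj₂ (move a c z)) ++ γ)

    simulate-step : ∀ a x b cs → WellFormed b cs →
      Σ Γ* λ b' → Σ (List Γ*) λ cs' → WellFormed b' cs'
        × dpda-step a (encodeConfig (x , b) (stack cs))
            ≡ just (encodeConfig (proj₁ (step a (x , b)) , b') (stack cs'))
        × step a (x , b ++ concat cs) ≡ (proj₁ (step a (x , b)) , b' ++ concat cs')
    simulate-step a x b cs wf with push-correct (proj₂ (step a (x , b))) cs (all-chunks wf)
    ... | cs' , wf' , stack-eq , concat-eq = _ , cs' , wf' , dpda-eq , aut-eq
      where
      zs = proj₂ (move a (x , b) (top cs))
      dpda-eq = trans (dpda-step-encoded a (x , b) (top cs) (map encodeSymbol (below cs))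
                         (decode-encodeState x b (buffer-fits wf)) (decode-encodeTop cs (all-chunks wf)))
                  (cong (λ γ → just (encodeState (proj₁ (move a (x , b) (top cs))) , γ))
                    (trans (sym (map-++ encodeSymbol zs (below cs))) (cong (map encodeSymbol) stack-eq)))
      aut-eq = trans (step-deep a x (deep wf)) (cong (proj₁ (step a (x , b)) ,_) concat-eq)

    simulate : ∀ w x b cs → WellFormed b cs →
      accepting (dpda-run (encodeConfig (x , b) (stack cs)) w) ≡ output (run (x , b ++ concat cs) w)
    simulate [] x b cs wf = begin
      output (decodeState (encodeState (x , b)))
        ≡⟨ cong output (decode-encodeState x b (buffer-fits wf)) ⟩
      output (x , b)
        ≡⟨ output-deep x (deep wf) ⟨
      output (x , b ++ concat cs) ∎
    simulate (a ∷ w) x b cs wf with simulate-step a x b cs wf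
    ... | b' , cs' , wf' , dpda-eq , aut-eq = begin
      accepting (dpda-run (encodeConfig (x , b) (stack cs)) (a ∷ w))
        ≡⟨ cong accepting (runFrom-step w dpda-eq) ⟩
      accepting (dpda-run (encodeConfig (x' , b') (stack cs')) w)
        ≡⟨ simulate w x' b' cs' wf' ⟩
      output (run (x' , b' ++ concat cs') w)
        ≡⟨ cong (λ c → output (run c w)) aut-eq ⟨
      output (run (x , b ++ concat cs) (a ∷ w)) ∎
      where x' = proj₁ (step a (x , b))

    dpda-accepts : ∀ w → Accepts (dpda x₀ γ₀) w ≡ trace m x₀ w (γ₀ ∷ [])
    dpda-accepts w = begin
      Accepts (dpda x₀ γ₀) w
        ≡⟨ accepts≡accepting w ⟩
      accepting (dpda-run (encodeConfig (x₀ , γ₀ ∷ []) (stack [])) w)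
        ≡⟨ simulate w x₀ (γ₀ ∷ []) [] initial ⟩
      output (run (x₀ , γ₀ ∷ []) w)
        ≡⟨ trace≡run x₀ w (γ₀ ∷ []) ⟨
      trace m x₀ w (γ₀ ∷ []) ∎
      where
      initial : WellFormed (γ₀ ∷ []) []
      initial = record { all-chunks = [] ; buffer-fits = ≤-trans 0<K (m≤m+n K _) ; deep = inj₁ refl }

stackAut⇒RTDCFL : ∀ {nA nΓ nX} (m : StackAut nA nΓ nX) x₀ γ₀ → IsRTDCFL (traceLang m x₀ γ₀)
stackAut⇒RTDCFL m x₀ γ₀ with Configurations.bounded-locality m
... | K , 0<K , local = _ , _ , dpda x₀ γ₀ , λ w →
  mk⇔ (trans (dpda-accepts x₀ γ₀ w)) (trans (sym (dpda-accepts x₀ γ₀ w)))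
  where open ToRTDPDA m K 0<K local

RTDCFL⇒stackAut : ∀ {nA} (L : Language nA) → IsRTDCFL L →
  Σ ℕ λ nΓ → Σ ℕ λ nX → Σ (StackAut nA nΓ nX) λ m → Σ (Fin nX) λ x₀ → Σ (Fin nΓ) λ γ₀ →
    (w : List (Fin nA)) → L w ⇔ traceLang m x₀ γ₀ w
RTDCFL⇒stackAut L (_ , nΣ , P , L⇔P) = nΣ , _ , automaton , suc (RTDPDA.q₀ P) , RTDPDA.Z₀ P , λ w →
  ⇔-trans (L⇔P w) (mk⇔ (trans (trace-automaton w)) (trans (sym (trace-automaton w))))
  where open FromRTDPDA P

theorem4 : (nA : ℕ) →
    ((nΓ nX : ℕ) (m : StackAut nA nΓ nX) (x₀ : Fin nX) (γ₀ : Fin nΓ) →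
       IsRTDCFL (traceLang m x₀ γ₀))
    × ((L : Language nA) → IsRTDCFL L →
       Σ ℕ λ nΓ → Σ ℕ λ nX → Σ (StackAut nA nΓ nX) λ m → Σ (Fin nX) λ x₀ → Σ (Fin nΓ) λ γ₀ →
         (w : List (Fin nA)) → L w ⇔ traceLang m x₀ γ₀ w)
theorem4 nA = (λ _ _ → stackAut⇒RTDCFL) , RTDCFL⇒stackAut
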